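{- For each natural number $k>0$, $\mathsf{HA}+\mathrm{DNS}(\mathrm{U}_k^+)\vdash\neg\neg\mathrm{DNE}(\Sigma_{k-1})$.
   Context: $\mathsf{HA}$ is intuitionistic (Heyting) arithmetic in the language with function symbols for all primitive recursive functions and logical constants $\forall,\exists,\to,\land,\lor,\perp$; $\neg\varphi$ abbreviates $\varphi\to\perp$. $S+\mathrm{P}$ adds all instances of schema $\mathrm{P}$ to $S$; $S\vdash\mathrm{P}$ means all instances of $\mathrm{P}$ are provable. $\Sigma_0=\Pi_0$ are the quantifier-free formulas; $\Pi_{k+1}$: formulas $Q_1\bar x_1\cdots Q_{k+1}\bar x_{k+1}\varphi_{qf}$ ($Q_i=\forall$ for odd $i$, $\exists$ for even $i$); $\Sigma_{k+1}$ likewise starting with $\exists$. $\Gamma(x,y)$: formulas in $\Gamma$ with free variables among $x,y$. $\mathrm{DNE}(\Gamma)$: $\forall x(\neg\neg\varphi(x)\to\varphi(x))$, $\varphi(x)\in\Gamma(x)$; $\neg\neg\mathrm{DNE}(\Gamma)$: $\neg\neg\xi$ for $\xi$ an instance (a sentence) of $\mathrm{DNE}(\Gamma)$. $\mathrm{DNS}(\Gamma)$: $\forall x(\forall y\neg\neg\varphi(x,y)\to\neg\neg\forall y\varphi(x,y))$, $\varphi(x,y)\in\Gamma(x,y)$. Alternation paths: finite alternating sequences of $+,-$; $i(s)$ first symbol ($\times$ if empty), $s^\perp$ swaps signs, $l(s)$ length. $\mathrm{Alt}(\varphi)=\{\langle\rangle\}$ for quantifier-free $\varphi$; otherwise $\mathrm{Alt}(\neg\varphi_1)=\{s^\perp:s\in\mathrm{Alt}(\varphi_1)\}$,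 $\mathrm{Alt}(\varphi_1\land\varphi_2)=\mathrm{Alt}(\varphi_1\lor\varphi_2)=\mathrm{Alt}(\varphi_1)\cup\mathrm{Alt}(\varphi_2)$, $\mathrm{Alt}(\varphi_1\to\varphi_2)=\{s^\perp:s\in\mathrm{Alt}(\varphi_1)\}\cup\mathrm{Alt}(\varphi_2)$, $\mathrm{Alt}(\forall x\varphi_1)=\{s\in\mathrm{Alt}(\varphi_1):i(s)=-\}\cup\{ -s:s\in\mathrm{Alt}(\varphi_1),i(s)\ne-\}$, $\mathrm{Alt}(\exists x\varphi_1)=\{s\in\mathrm{Alt}(\varphi_1):i(s)=+\}\cup\{+s:s\in\mathrm{Alt}(\varphi_1),i(s)\ne+\}$. $\deg\varphi=\max\{l(s):s\in\mathrm{Alt}(\varphi)\}$, $\mathrm{F}_k=\{\varphi:\deg\varphi=k\}$, $\mathrm{U}_0=\mathrm{F}_0$, $\mathrm{U}_{k+1}=\{\varphi\in\mathrm{F}_{k+1}:i(s)=-$ for all $s\in\mathrm{Alt}(\varphi)$ with $l(s)=k+1\}$, $\mathrm{U}_k^+=\mathrm{U}_k\cup\bigcup_{i<k}\mathrm{F}_i$. -}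

module Defs where

open import Data.Nat using (ℕ; zero; suc; _<_; _⊔_; _∸_)
open import Data.Fin using (Fin)
open import Data.Vec using (Vec; []; _∷_; lookup) renaming (map to vmap)
open import Data.Vec.Relation.Unary.All using () renaming (All to AllV)
open import Data.List using (List; []; _∷_; _++_; length; map; foldr)
open import Data.List.Relation.Unary.All using (All)
open import Data.List.Membership.Propositional using (_∈_)
open import Data.Product using (Σ; _×_; _,_)
open import Data.Sum using (_⊎_)
open import Data.Unit using (⊤)
open import Data.Empty using (⊥)
open import Relation.Binary.PropositionalEquality using (_≡_)

-- Primitive recursive function symbols (one symbol per PR definition)

data PR : ℕ → Set where
  zer  : PR 0
  succ : PR 1
  proj : ∀ {n} → Fin n → PR n
  comp : ∀ {m n} → PR m → Vec (PR n) m → PR n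
  rec  : ∀ {n} → PR n → PR (suc (suc n)) → PR (suc n)
  -- rec g h (0 , xs) = g xs ;  rec g h (S y , xs) = h (y , rec g h (y , xs) , xs)

-- Terms and formulas (de Bruijn indices)

data Term : Set where
  var : ℕ → Term
  app : ∀ {n} → PR n → Vec Term n → Term

𝟎 : Term
𝟎 = app zer []

S : Term → Term
S t = app succ (t ∷ [])

infixr 6 _⇒_
infixr 7 _∨'_
infixr 8 _∧'_
infix 9 _≐_

data Formula : Set where
  _≐_  : Term → Term → Formula
  ⊥'   : Formula
  _∧'_ : Formula → Formula → Formula
  _∨'_ : Formula → Formula → Formula
  _⇒_  : Formula → Formula → Formula
  ∀'   : Formula → Formula
  ∃'   : Formula → Formula

¬' : Formula → Formula
¬' φ = φ ⇒ ⊥'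

∀ⁿ : ℕ → Formula → Formula
∀ⁿ zero φ = φ
∀ⁿ (suc n) φ = ∀' (∀ⁿ n φ)

Subst : Set
Subst = ℕ → Term

mutual
  substT : Subst → Term → Term
  substT σ (var i) = σ i
  substT σ (app f ts) = app f (substTs σ ts)

  substTs : ∀ {n} → Subst → Vec Term n → Vec Term n
  substTs σ [] = []
  substTs σ (t ∷ ts) = substT σ t ∷ substTs σ ts

shiftT : Term → Term
shiftT = substT (λ i → var (suc i))

lift : Subst → Subst
lift σ zero = var zero
lift σ (suc i) = shiftT (σ i)

substF : Subst → Formula → Formula
substF σ (t ≐ s) = substT σ t ≐ substT σ s
substF σ ⊥' = ⊥'
substF σ (φ ∧' ψ) = substF σ φ ∧' substF σ ψ
substF σ (φ ∨' ψ) = substF σ φ ∨' substF σ ψ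
substF σ (φ ⇒ ψ) = substF σ φ ⇒ substF σ ψ
substF σ (∀' φ) = ∀' (substF (lift σ) φ)
substF σ (∃' φ) = ∃' (substF (lift σ) φ)

shiftF : Formula → Formula
shiftF = substF (λ i → var (suc i))

-- φ[t/x₀] (remaining variables move down by one)
sub0 : Term → Subst
sub0 t zero = t
sub0 t (suc i) = var i

_[_] : Formula → Term → Formula
φ [ t ] = substF (sub0 t) φ

sucSub : Subst
sucSub zero = S (var zero)
sucSub (suc i) = var (suc i)

data TmBelow (n : ℕ) : Term → Set where
  var : ∀ {i} → i < n → TmBelow n (var i)
  app : ∀ {m} {f : PR m} {ts : Vec Term m} → AllV (TmBelow n) ts → TmBelow n (app f ts)

data FmBelow : ℕ → Formula → Set where
  eq  : ∀ {n t s} → TmBelow n t → TmBelow n s → FmBelow n (t ≐ s)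
  bot : ∀ {n} → FmBelow n ⊥'
  and : ∀ {n φ ψ} → FmBelow n φ → FmBelow n ψ → FmBelow n (φ ∧' ψ)
  or  : ∀ {n φ ψ} → FmBelow n φ → FmBelow n ψ → FmBelow n (φ ∨' ψ)
  imp : ∀ {n φ ψ} → FmBelow n φ → FmBelow n ψ → FmBelow n (φ ⇒ ψ)
  all : ∀ {n φ} → FmBelow (suc n) φ → FmBelow n (∀' φ)
  ex  : ∀ {n φ} → FmBelow (suc n) φ → FmBelow n (∃' φ)

-- HA (intuitionistic natural deduction) extended by extra axioms T

Theory : Set₁
Theory = Formula → Set

infix 4 Prf

data Prf (T : Theory) : List Formula → Formula → Set where
  axT   : ∀ {Γ φ} → T φ → Prf T Γ φ
  hyp   : ∀ {Γ φ} → φ ∈ Γ → Prf T Γ φ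
  ⊥E    : ∀ {Γ φ} → Prf T Γ ⊥' → Prf T Γ φ
  ∧I    : ∀ {Γ φ ψ} → Prf T Γ φ → Prf T Γ ψ → Prf T Γ (φ ∧' ψ)
  ∧E₁   : ∀ {Γ φ ψ} → Prf T Γ (φ ∧' ψ) → Prf T Γ φ
  ∧E₂   : ∀ {Γ φ ψ} → Prf T Γ (φ ∧' ψ) → Prf T Γ ψ
  ∨I₁   : ∀ {Γ φ ψ} → Prf T Γ φ → Prf T Γ (φ ∨' ψ)
  ∨I₂   : ∀ {Γ φ ψ} → Prf T Γ ψ → Prf T Γ (φ ∨' ψ)
  ∨E    : ∀ {Γ φ ψ χ} → Prf T Γ (φ ∨' ψ) → Prf T (φ ∷ Γ) χ → Prf T (ψ ∷ Γ) χ → Prf T Γ χ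
  ⇒I    : ∀ {Γ φ ψ} → Prf T (φ ∷ Γ) ψ → Prf T Γ (φ ⇒ ψ)
  ⇒E    : ∀ {Γ φ ψ} → Prf T Γ (φ ⇒ ψ) → Prf T Γ φ → Prf T Γ ψ
  ∀I    : ∀ {Γ φ} → Prf T (map shiftF Γ) φ → Prf T Γ (∀' φ)
  ∀E    : ∀ {Γ φ} (t : Term) → Prf T Γ (∀' φ) → Prf T Γ (φ [ t ])
  ∃I    : ∀ {Γ φ} (t : Term) → Prf T Γ (φ [ t ]) → Prf T Γ (∃' φ)
  ∃E    : ∀ {Γ φ ψ} → Prf T Γ (∃' φ) → Prf T (φ ∷ map shiftF Γ) (shiftF ψ) → Prf T Γ ψ
  refl≐ : ∀ {Γ} (t : Term) → Prf T Γ (t ≐ t)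
  subst≐ : ∀ {Γ φ t s} → Prf T Γ (t ≐ s) → Prf T Γ (φ [ t ]) → Prf T Γ (φ [ s ])
  S≠0   : ∀ {Γ} (t : Term) → Prf T Γ (¬' (S t ≐ 𝟎))
  S-inj : ∀ {Γ} (t s : Term) → Prf T Γ (S t ≐ S s ⇒ t ≐ s)
  eqProj : ∀ {Γ n} (i : Fin n) (ts : Vec Term n) → Prf T Γ (app (proj i) ts ≐ lookup ts i)
  eqComp : ∀ {Γ m n} (h : PR m) (gs : Vec (PR n) m) (ts : Vec Term n) →
           Prf T Γ (app (comp h gs) ts ≐ app h (vmap (λ g → app g ts) gs))
  eqRec0 : ∀ {Γ n} (g : PR n) (h : PR (suc (suc n))) (ts : Vec Term n) →
           Prf T Γ (app (rec g h) (𝟎 ∷ ts) ≐ app g ts)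
  eqRecS : ∀ {Γ n} (g : PR n) (h : PR (suc (suc n))) (t : Term) (ts : Vec Term n) →
           Prf T Γ (app (rec g h) (S t ∷ ts) ≐ app h (t ∷ app (rec g h) (t ∷ ts) ∷ ts))
  ind   : ∀ {Γ φ} → Prf T Γ (φ [ 𝟎 ]) → Prf T Γ (∀' (φ ⇒ substF sucSub φ)) → Prf T Γ (∀' φ)

-- A schema is given by the predicate "is an instance of it"
Schema : Set₁
Schema = Formula → Set

HA+ : Schema → Theory
HA+ P = P

_⊢ˢ_ : Theory → Schema → Set
T ⊢ˢ P = ∀ ξ → P ξ → Prf T [] ξ

FClass : Set₁
FClass = Formula → Set

data QF : Formula → Set where
  eq  : ∀ {t s} → QF (t ≐ s)
  bot : QF ⊥'
  and : ∀ {φ ψ} → QF φ → QF ψ → QF (φ ∧' ψ)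
  or  : ∀ {φ ψ} → QF φ → QF ψ → QF (φ ∨' ψ)
  imp : ∀ {φ ψ} → QF φ → QF ψ → QF (φ ⇒ ψ)

-- Σ_k / Π_k prenex formulas (nonempty quantifier blocks)
mutual
  data Σₖ : ℕ → Formula → Set where
    qf    : ∀ {φ} → QF φ → Σₖ 0 φ
    ∃more : ∀ {k φ} → Σₖ (suc k) φ → Σₖ (suc k) (∃' φ)
    ∃last : ∀ {k φ} → Πₖ k φ → Σₖ (suc k) (∃' φ)

  data Πₖ : ℕ → Formula → Set where
    qf    : ∀ {φ} → QF φ → Πₖ 0 φ
    ∀more : ∀ {k φ} → Πₖ (suc k) φ → Πₖ (suc k) (∀' φ)
    ∀last : ∀ {k φ} → Σₖ k φ → Πₖ (suc k) (∀' φ)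

data Sign : Set where
  plus minus : Sign

Path : Set
Path = List Sign

flip : Sign → Sign
flip plus = minus
flip minus = plus

_⊥ₚ : Path → Path
s ⊥ₚ = map flip s

prepend : Sign → Path → Path
prepend q [] = q ∷ []
prepend plus (plus ∷ s) = plus ∷ s
prepend plus (minus ∷ s) = plus ∷ minus ∷ s
prepend minus (minus ∷ s) = minus ∷ s
prepend minus (plus ∷ s) = minus ∷ plus ∷ s

Alt : Formula → List Path
Alt (t ≐ s) = [] ∷ []
Alt ⊥' = [] ∷ []
Alt (φ ∧' ψ) = Alt φ ++ Alt ψ
Alt (φ ∨' ψ) = Alt φ ++ Alt ψ
Alt (φ ⇒ ψ) = map _⊥ₚ (Alt φ) ++ Alt ψ
Alt (∀' φ) = map (prepend minus) (Alt φ)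
Alt (∃' φ) = map (prepend plus) (Alt φ)

deg : Formula → ℕ
deg φ = foldr _⊔_ 0 (map length (Alt φ))

F : ℕ → FClass
F k φ = deg φ ≡ k

StartsMinus : Path → Set
StartsMinus (minus ∷ _) = ⊤
StartsMinus _ = ⊥

U : ℕ → FClass
U zero φ = F 0 φ
U (suc k) φ = F (suc k) φ × All (λ s → length s ≡ suc k → StartsMinus s) (Alt φ)

U⁺ : ℕ → FClass
U⁺ k φ = U k φ ⊎ deg φ < k

DNE : FClass → Schema
DNE Γ ξ = Σ ℕ λ n → Σ Formula λ φ → Γ φ × FmBelow n φ × (ξ ≡ ∀ⁿ n (¬' (¬' φ) ⇒ φ))

¬¬DNE : FClass → Schema
¬¬DNE Γ ξ = Σ Formula λ ζ → DNE Γ ζ × (ξ ≡ ¬' (¬' ζ))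

-- instances of DNS(Γ): ∀x̄(∀y¬¬φ(x̄,y) → ¬¬∀yφ(x̄,y)); y is variable 0
DNS : FClass → Schema
DNS Γ ξ = Σ ℕ λ n → Σ Formula λ φ → Γ φ × FmBelow (suc n) φ ×
            (ξ ≡ ∀ⁿ n (∀' (¬' (¬' φ)) ⇒ ¬' (¬' (∀' φ))))

module Submission where

-- ¬¬(¬¬φ → φ) is an intuitionistic tautology. Writing ψ = ¬¬φ → φ, the
-- universal prefix of ¬¬∀x₁…∀xₙ ψ is then introduced one variable at a time:
-- ∀x̄∀y ¬¬(∀z̄ ψ) yields ∀x̄ ¬¬∀y∀z̄ ψ by the DNS instance for ∀z̄ ψ. For
-- φ ∈ Σ_{k-1} every alternation path of ψ has length < k, so prefixing
-- universal quantifiers only creates paths of length k that start with −;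
-- hence each ∀z̄ ψ lies in U_k⁺.

open import Defs
open import Data.Nat using (ℕ; zero; suc; _+_; _≤_; _<_; _∸_; _⊔_; _≟_; _<?_; z≤n; s≤s)
open import Data.Nat.Properties using (+-suc; +-comm; ≤-reflexive; <⇒≤; <⇒≢; ≤∧≢⇒<; ⊔-lub; ≤-antisym; ≮⇒≥)
open import Data.Vec using (Vec; []; _∷_)
open import Data.List using (List; []; _∷_; length; map; foldr)
open import Data.List.Properties using (length-map)
open import Data.List.Relation.Unary.All using (All; []; _∷_) renaming (map to All-map)
open import Data.List.Relation.Unary.All.Properties using (++⁺; map⁺)
open import Data.List.Relation.Unary.Any using (here; there)
open import Data.Product using (_×_; _,_; proj₁; proj₂)
open import Data.Sum using (inj₁; inj₂)
open import Data.Unit using (tt)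
open import Data.Empty using (⊥-elim)
open import Relation.Nullary using (yes; no)
open import Relation.Binary.PropositionalEquality using (_≡_; _≗_; refl; sym; trans; cong; cong₂; subst)

_∘ˢ_ : (Term → Term) → Subst → Subst
(f ∘ˢ τ) i = f (τ i)

mutual
  substT-cong : ∀ {σ τ : Subst} → σ ≗ τ → substT σ ≗ substT τ
  substT-cong e (var i) = e i
  substT-cong e (app f ts) = cong (app f) (substTs-cong e ts)

  substTs-cong : ∀ {n} {σ τ : Subst} → σ ≗ τ → (ts : Vec Term n) → substTs σ ts ≡ substTs τ ts
  substTs-cong e [] = refl
  substTs-cong e (t ∷ ts) = cong₂ _∷_ (substT-cong e t) (substTs-cong e ts)

mutual
  substT-∘ : ∀ (σ τ : Subst) t → substT σ (substT τ t) ≡ substT (substT σ ∘ˢ τ) t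
  substT-∘ σ τ (var i) = refl
  substT-∘ σ τ (app f ts) = cong (app f) (substTs-∘ σ τ ts)

  substTs-∘ : ∀ {n} (σ τ : Subst) (ts : Vec Term n) →
              substTs σ (substTs τ ts) ≡ substTs (substT σ ∘ˢ τ) ts
  substTs-∘ σ τ [] = refl
  substTs-∘ σ τ (t ∷ ts) = cong₂ _∷_ (substT-∘ σ τ t) (substTs-∘ σ τ ts)

mutual
  substT-id : ∀ {σ : Subst} → σ ≗ var → substT σ ≗ (λ t → t)
  substT-id e (var i) = e i
  substT-id e (app f ts) = cong (app f) (substTs-id e ts)

  substTs-id : ∀ {n} {σ : Subst} → σ ≗ var → (ts : Vec Term n) → substTs σ ts ≡ ts
  substTs-id e [] = refl
  substTs-id e (t ∷ ts) = cong₂ _∷_ (substT-id e t) (substTs-id e ts)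

lift-cong : ∀ {σ τ : Subst} → σ ≗ τ → lift σ ≗ lift τ
lift-cong e zero = refl
lift-cong e (suc i) = cong shiftT (e i)

lift-∘ : ∀ (σ τ : Subst) → substT (lift σ) ∘ˢ lift τ ≗ lift (substT σ ∘ˢ τ)
lift-∘ σ τ zero = refl
lift-∘ σ τ (suc i) = trans (substT-∘ (lift σ) _ (τ i)) (sym (substT-∘ _ σ (τ i)))

lift-id : ∀ {σ : Subst} → σ ≗ var → lift σ ≗ var
lift-id e zero = refl
lift-id e (suc i) = cong shiftT (e i)

substF-cong : ∀ {σ τ : Subst} → σ ≗ τ → substF σ ≗ substF τ
substF-cong e (t ≐ s) = cong₂ _≐_ (substT-cong e t) (substT-cong e s)
substF-cong e ⊥' = refl
substF-cong e (φ ∧' ψ) = cong₂ _∧'_ (substF-cong e φ) (substF-cong e ψ)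
substF-cong e (φ ∨' ψ) = cong₂ _∨'_ (substF-cong e φ) (substF-cong e ψ)
substF-cong e (φ ⇒ ψ) = cong₂ _⇒_ (substF-cong e φ) (substF-cong e ψ)
substF-cong e (∀' φ) = cong ∀' (substF-cong (lift-cong e) φ)
substF-cong e (∃' φ) = cong ∃' (substF-cong (lift-cong e) φ)

substF-∘ : ∀ (σ τ : Subst) φ → substF σ (substF τ φ) ≡ substF (substT σ ∘ˢ τ) φ
substF-∘ σ τ (t ≐ s) = cong₂ _≐_ (substT-∘ σ τ t) (substT-∘ σ τ s)
substF-∘ σ τ ⊥' = refl
substF-∘ σ τ (φ ∧' ψ) = cong₂ _∧'_ (substF-∘ σ τ φ) (substF-∘ σ τ ψ)
substF-∘ σ τ (φ ∨' ψ) = cong₂ _∨'_ (substF-∘ σ τ φ) (substF-∘ σ τ ψ)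
substF-∘ σ τ (φ ⇒ ψ) = cong₂ _⇒_ (substF-∘ σ τ φ) (substF-∘ σ τ ψ)
substF-∘ σ τ (∀' φ) = cong ∀' (trans (substF-∘ (lift σ) (lift τ) φ) (substF-cong (lift-∘ σ τ) φ))
substF-∘ σ τ (∃' φ) = cong ∃' (trans (substF-∘ (lift σ) (lift τ) φ) (substF-cong (lift-∘ σ τ) φ))

substF-id : ∀ {σ : Subst} → σ ≗ var → substF σ ≗ (λ φ → φ)
substF-id e (t ≐ s) = cong₂ _≐_ (substT-id e t) (substT-id e s)
substF-id e ⊥' = refl
substF-id e (φ ∧' ψ) = cong₂ _∧'_ (substF-id e φ) (substF-id e ψ)
substF-id e (φ ∨' ψ) = cong₂ _∨'_ (substF-id e φ) (substF-id e ψ)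
substF-id e (φ ⇒ ψ) = cong₂ _⇒_ (substF-id e φ) (substF-id e ψ)
substF-id e (∀' φ) = cong ∀' (substF-id (lift-id e) φ)
substF-id e (∃' φ) = cong ∃' (substF-id (lift-id e) φ)

shift-under-∀-inst : ∀ φ → substF (lift (λ i → var (suc i))) φ [ var 0 ] ≡ φ
shift-under-∀-inst φ = trans (substF-∘ (sub0 (var 0)) _ φ) (substF-id inst φ)
  where
  inst : substT (sub0 (var 0)) ∘ˢ lift (λ i → var (suc i)) ≗ var
  inst zero = refl
  inst (suc i) = refl

¬¬' : Formula → Formula
¬¬' φ = ¬' (¬' φ)

∀ⁿ-suc : ∀ m φ → ∀ⁿ (suc m) φ ≡ ∀ⁿ m (∀' φ)
∀ⁿ-suc zero φ = refl
∀ⁿ-suc (suc m) φ = cong ∀' (∀ⁿ-suc m φ)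

FmBelow-∀ⁿ : ∀ j q {φ} → FmBelow (j + q) φ → FmBelow q (∀ⁿ j φ)
FmBelow-∀ⁿ zero q fb = fb
FmBelow-∀ⁿ (suc j) q {φ} fb = all (FmBelow-∀ⁿ j (suc q) (subst (λ n → FmBelow n φ) (sym (+-suc j q)) fb))

module _ {T : Theory} where

  -- ∀I shifts the context, so a hypothesis ∀ φ reappears with φ shifted under the binder.
  ∀-unshift : ∀ {Γ φ} → Prf T Γ (∀' (substF (lift (λ i → var (suc i))) φ)) → Prf T Γ φ
  ∀-unshift {φ = φ} p = subst (Prf T _) (shift-under-∀-inst φ) (∀E (var 0) p)

  ∀ⁿ-distrib-⇒ : ∀ m {Γ φ ψ} → Prf T Γ (∀ⁿ m (φ ⇒ ψ) ⇒ ∀ⁿ m φ ⇒ ∀ⁿ m ψ)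
  ∀ⁿ-distrib-⇒ zero = ⇒I (⇒I (⇒E (hyp (there (here refl))) (hyp (here refl))))
  ∀ⁿ-distrib-⇒ (suc m) =
    ⇒I (⇒I (∀I (⇒E (⇒E (∀ⁿ-distrib-⇒ m) (∀-unshift (hyp (there (here refl)))))
                   (∀-unshift (hyp (here refl))))))

  ∀ⁿ-gen : ∀ m {φ} → Prf T [] φ → Prf T [] (∀ⁿ m φ)
  ∀ⁿ-gen zero p = p
  ∀ⁿ-gen (suc m) p = ∀I (∀ⁿ-gen m p)

  ¬¬-dne : ∀ {Γ} φ → Prf T Γ (¬¬' (¬¬' φ ⇒ φ))
  ¬¬-dne φ =
    ⇒I (⇒E (hyp (here refl))
           (⇒I (⊥E (⇒E (hyp (here refl))
                       (⇒I (⇒E (hyp (there (there (here refl)))) (⇒I (hyp (there (here refl))))))))))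

DNS-¬¬-∀ⁿ : ∀ {Γ ψ} → (∀ j → Γ (∀ⁿ j ψ)) → Prf (HA+ (DNS Γ)) [] (¬¬' ψ) →
            ∀ j m → FmBelow (m + j) ψ → Prf (HA+ (DNS Γ)) [] (∀ⁿ m (¬¬' (∀ⁿ j ψ)))
DNS-¬¬-∀ⁿ Γψ ¬¬ψ zero m fb = ∀ⁿ-gen m ¬¬ψ
DNS-¬¬-∀ⁿ {Γ} {ψ} Γψ ¬¬ψ (suc j) m fb =
  ⇒E (⇒E (∀ⁿ-distrib-⇒ m) dns) (subst (Prf _ []) (∀ⁿ-suc m _) ¬¬∀ⁿj)
  where
  fb′ : FmBelow (suc m + j) ψ
  fb′ = subst (λ n → FmBelow n ψ) (+-suc m j) fb

  ¬¬∀ⁿj : Prf (HA+ (DNS Γ)) [] (∀ⁿ (suc m) (¬¬' (∀ⁿ j ψ)))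
  ¬¬∀ⁿj = DNS-¬¬-∀ⁿ Γψ ¬¬ψ j (suc m) fb′

  dns : Prf (HA+ (DNS Γ)) [] (∀ⁿ m (∀' (¬¬' (∀ⁿ j ψ)) ⇒ ¬¬' (∀ⁿ (suc j) ψ)))
  dns = axT (m , ∀ⁿ j ψ , Γψ j ,
             FmBelow-∀ⁿ j (suc m) (subst (λ n → FmBelow n ψ) (+-comm (suc m) j) fb′) , refl)

alternating : Sign → ℕ → Path
alternating q zero = []
alternating q (suc m) = q ∷ alternating (flip q) m

length-alternating : ∀ q m → length (alternating q m) ≡ m
length-alternating q zero = refl
length-alternating q (suc m) = cong suc (length-alternating (flip q) m)

prepend-alternating : ∀ q m → prepend q (alternating (flip q) m) ≡ alternating q (suc m)
prepend-alternating plus zero = refl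
prepend-alternating plus (suc m) = refl
prepend-alternating minus zero = refl
prepend-alternating minus (suc m) = refl

Alt-QF : ∀ {φ} → QF φ → All (_≡ []) (Alt φ)
Alt-QF eq = refl ∷ []
Alt-QF bot = refl ∷ []
Alt-QF (and a b) = ++⁺ (Alt-QF a) (Alt-QF b)
Alt-QF (or a b) = ++⁺ (Alt-QF a) (Alt-QF b)
Alt-QF (imp a b) = ++⁺ (map⁺ (All-map (cong _⊥ₚ) (Alt-QF a))) (Alt-QF b)

mutual
  Alt-Σₖ : ∀ {m φ} → Σₖ m φ → All (_≡ alternating plus m) (Alt φ)
  Alt-Σₖ (qf q) = Alt-QF q
  Alt-Σₖ (∃more s) = map⁺ (All-map (λ { refl → refl }) (Alt-Σₖ s))
  Alt-Σₖ {suc m} (∃last p) = map⁺ (All-map (λ { refl → prepend-alternating plus m }) (Alt-Πₖ p))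

  Alt-Πₖ : ∀ {m φ} → Πₖ m φ → All (_≡ alternating minus m) (Alt φ)
  Alt-Πₖ (qf q) = Alt-QF q
  Alt-Πₖ (∀more p) = map⁺ (All-map (λ { refl → refl }) (Alt-Πₖ p))
  Alt-Πₖ {suc m} (∀last s) = map⁺ (All-map (λ { refl → prepend-alternating minus m }) (Alt-Σₖ s))

AltShorter : ℕ → Formula → Set
AltShorter k φ = All (λ s → length s < k) (Alt φ)

AltShorter-Σₖ : ∀ {k φ} → Σₖ k φ → AltShorter (suc k) φ
AltShorter-Σₖ {k} σφ = All-map (λ { refl → s≤s (≤-reflexive (length-alternating plus k)) }) (Alt-Σₖ σφ)

AltShorter-⊥' : ∀ {k} → AltShorter (suc k) ⊥'
AltShorter-⊥' = s≤s z≤n ∷ []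

AltShorter-⇒ : ∀ {k} φ ψ → AltShorter k φ → AltShorter k ψ → AltShorter k (φ ⇒ ψ)
AltShorter-⇒ {k} φ ψ a b = ++⁺ (map⁺ (All-map (λ {s} l → subst (_< k) (sym (length-map flip s)) l) a)) b

AltShorter-dne : ∀ {k} φ → AltShorter (suc k) φ → AltShorter (suc k) (¬¬' φ ⇒ φ)
AltShorter-dne φ a =
  AltShorter-⇒ (¬¬' φ) φ (AltShorter-⇒ (¬' φ) ⊥' (AltShorter-⇒ φ ⊥' a AltShorter-⊥') AltShorter-⊥') a

UPath : ℕ → Path → Set
UPath k s = length s ≤ k × (length s ≡ k → StartsMinus s)

AltU : ℕ → Formula → Set
AltU k φ = All (UPath k) (Alt φ)

AltShorter⇒AltU : ∀ {k} φ → AltShorter k φ → AltU k φ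
AltShorter⇒AltU φ = All-map (λ l → <⇒≤ l , λ e → ⊥-elim (<⇒≢ l e))

UPath-prepend-minus : ∀ k s → UPath (suc k) s → UPath (suc k) (prepend minus s)
UPath-prepend-minus k [] _ = s≤s z≤n , λ _ → tt
UPath-prepend-minus k (minus ∷ s) u = u
UPath-prepend-minus k (plus ∷ s) (l , starts) with suc (length s) ≟ suc k
... | yes e = ⊥-elim (starts e)
... | no ne = ≤∧≢⇒< l ne , λ _ → tt

AltU-∀ⁿ : ∀ k j φ → AltU (suc k) φ → AltU (suc k) (∀ⁿ j φ)
AltU-∀ⁿ k zero φ u = u
AltU-∀ⁿ k (suc j) φ u = map⁺ (All-map (λ {s} → UPath-prepend-minus k s) (AltU-∀ⁿ k j φ u))

deg-≤ : ∀ {k} φ → All (λ s → length s ≤ k) (Alt φ) → deg φ ≤ k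
deg-≤ φ = go (Alt φ)
  where
  go : ∀ {k} (L : List Path) → All (λ s → length s ≤ k) L → foldr _⊔_ 0 (map length L) ≤ k
  go [] [] = z≤n
  go (s ∷ L) (l ∷ ls) = ⊔-lub l (go L ls)

AltU⇒U⁺ : ∀ k φ → AltU (suc k) φ → U⁺ (suc k) φ
AltU⇒U⁺ k φ u with deg φ <? suc k
... | yes lt = inj₂ lt
... | no ¬lt = inj₁ (≤-antisym (deg-≤ φ (All-map proj₁ u)) (≮⇒≥ ¬lt) , All-map proj₂ u)

corollary4p10 : (k : ℕ) → 0 < k → HA+ (DNS (U⁺ k)) ⊢ˢ ¬¬DNE (Σₖ (k ∸ 1))
corollary4p10 (suc k) _ _ (_ , (n , φ , σφ , fb , refl) , refl) =
  DNS-¬¬-∀ⁿ body∈U⁺ (¬¬-dne φ) n 0 (imp (imp (imp fb bot) bot) fb)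
  where
  ψ : Formula
  ψ = ¬¬' φ ⇒ φ

  body∈U⁺ : ∀ j → U⁺ (suc k) (∀ⁿ j ψ)
  body∈U⁺ j = AltU⇒U⁺ k (∀ⁿ j ψ) (AltU-∀ⁿ k j ψ (AltShorter⇒AltU ψ (AltShorter-dne φ (AltShorter-Σₖ σφ))))
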